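{- Let $F=P_{\ell_1}\cup\cdots\cup P_{\ell_k}$ be a linear forest with $k\ge 2$ and $\ell_i\neq 3$ for all $1\le i\le k$. If the graph $P_{2\delta_F+1}\cup P_{\delta_F}$ contains no copy of $F$, then either $F\in\{5P_5,\ 2P_\ell,\ P_{\ell+1}\cup P_\ell\}$ for some $\ell$, or $F\in\{P_{\ell+2}\cup P_\ell,\ 2P_\ell\cup P_2\}$ for some odd $\ell$.
   Context: $P_m$ is the path on $m$ vertices, $\cup$ denotes disjoint union and $kG$ is $k$ disjoint copies of $G$. A linear forest $F=P_{\ell_1}\cup\cdots\cup P_{\ell_k}$ (with $\ell_1\ge\cdots\ge\ell_k$) is a disjoint union of paths, and $\delta_F=\sum_{i=1}^k\lfloor \ell_i/2\rfloor-1$. -}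

module Defs where

open import Data.Nat using (ℕ; suc; _∸_; _/_)
open import Data.Fin using (Fin; toℕ)
open import Data.List using (List; []; _∷_; foldr; map)
open import Data.Nat.ListAction using (sum)
open import Data.Sum using (_⊎_; inj₁; inj₂)
open import Data.Product using (Σ; _×_)
open import Data.Empty using (⊥)
open import Relation.Binary.PropositionalEquality using (_≡_)
open import Function.Definitions using (Injective)

record Graph : Set₁ where
  field
    V : Set
    E : V → V → Set
open Graph public

P : ℕ → Graph
P m = record { V = Fin m ; E = λ i j → (suc (toℕ i) ≡ toℕ j) ⊎ (suc (toℕ j) ≡ toℕ i) }

emptyG : Graph
emptyG = record { V = ⊥ ; E = λ _ _ → ⊥ }

_∪G_ : Graph → Graph → Graph
G ∪G H = record { V = V G ⊎ V H ; E = adj }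
  where
  adj : V G ⊎ V H → V G ⊎ V H → Set
  adj (inj₁ a) (inj₁ b) = E G a b
  adj (inj₂ a) (inj₂ b) = E H a b
  adj (inj₁ _) (inj₂ _) = ⊥
  adj (inj₂ _) (inj₁ _) = ⊥

infixr 5 _∪G_

Contains : Graph → Graph → Set
Contains G H = Σ (V H → V G) λ f → Injective _≡_ _≡_ f × (∀ u v → E H u v → E G (f u) (f v))

linForest : List ℕ → Graph
linForest ls = foldr (λ m G → P m ∪G G) emptyG ls

δ : List ℕ → ℕ
δ ls = sum (map (λ l → l / 2) ls) ∸ 1

{-# OPTIONS --safe #-}
module Submission where

-- Write S = Σ ⌊ℓᵢ/2⌋ and O for the number of odd ℓᵢ, so that F has 2S + O vertices and
-- δ_F = S − 1. If the paths of F split into two groups, the first with between O + 1 and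
-- S − 1 vertices, laying each group end to end embeds F into P_{2S−1} ∪ P_{S−1}.
-- If ℓ₂ ≤ S − 1, take the longest prefix of ℓ₂, ℓ₃, … with at most S − 1 vertices, t of them.
-- Either t > O, or the first path that does not fit, being no longer than ℓ₂ ≤ t, gives
-- S ≤ 2t ≤ 2O; but ⌊ℓ/2⌋ ≥ 2 (ℓ mod 2) for ℓ ∉ {1, 3}, with equality only at ℓ = 5, so F = 5P₅.
-- If ℓ₂ ≥ S, then ℓ₁ ≥ ℓ₂ leaves room for at most one further path, a P₂, and pins ℓ₁ down.

open import Defs
open import Data.Nat
  using (ℕ; zero; suc; _+_; _*_; _∸_; _%_; _/_; _≤_; _<_; _≥_; _≤?_; _<?_; z≤n; s≤s; s≤s⁻¹; ⌊_/2⌋)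
open import Data.Nat.Properties
open import Data.Nat.DivMod using (m/n≡1+[m∸n]/n; m%n≤m; m%n<n)
open import Data.Nat.ListAction using (sum)
open import Data.Nat.ListAction.Properties using (sum-++; sum-↭)
open import Data.Nat.Tactic.RingSolver using (solve-∀)
open import Data.Fin using (Fin; toℕ; join; splitAt; inject≤; _↑ˡ_; _↑ʳ_)
open import Data.Fin.Properties using (splitAt-join; toℕ-↑ˡ; toℕ-↑ʳ; toℕ-inject≤; inject≤-injective)
open import Data.List using (List; []; _∷_; _++_; length; map)
open import Data.List.Properties using (map-cong)
open import Data.List.Membership.Propositional using (_∈_)
open import Data.List.Membership.Propositional.Properties using (∈-++⁺ʳ)
open import Data.List.Relation.Unary.All as All using (All; []; _∷_; lookup)
open import Data.List.Relation.Unary.Any using (here; there)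
open import Data.List.Relation.Unary.AllPairs as AllPairs using ()
open import Data.List.Relation.Unary.Linked using (Linked; _∷_)
open import Data.List.Relation.Unary.Linked.Properties using (Linked⇒AllPairs)
import Data.List.Relation.Binary.Pointwise as Pointwise
open import Data.List.Relation.Ternary.Interleaving.Propositional
  using (Interleaving; []; consˡ; consʳ; left; right; toPermutation)
open import Data.List.Relation.Ternary.Interleaving.Properties using (++-disjoint)
open import Data.Sum using (_⊎_; inj₁; inj₂; swap; assocˡ; assocʳ) renaming (map to ⊎-map)
open import Data.Sum.Properties using (inj₁-injective; inj₂-injective; swap-involutive)
open import Data.Product using (∃; _×_; _,_)
open import Data.Empty using (⊥-elim)
open import Function.Definitions using (Injective)
open import Relation.Binary.PropositionalEquality
open import Relation.Nullary using (¬_; yes; no; contradiction)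

Contains-refl : ∀ {G} → Contains G G
Contains-refl = (λ x → x) , (λ e → e) , λ _ _ e → e

Contains-trans : ∀ {G H K} → Contains G H → Contains H K → Contains G K
Contains-trans (f , f-inj , f-adj) (g , g-inj , g-adj) =
  (λ x → f (g x)) , (λ e → g-inj (f-inj e)) , λ u v e → f-adj _ _ (g-adj u v e)

-- Agda cannot infer G and H from a proof of Contains G H (V and E are not injective),
-- so chains of embeddings spell out the intermediate graphs.
module ⊇-Reasoning where

  infixr 2 _⊇⟨_⟩_
  infix 3 _∎

  _⊇⟨_⟩_ : ∀ G {H K} → Contains G H → Contains H K → Contains G K
  G ⊇⟨ G⊇H ⟩ H⊇K = Contains-trans {G} G⊇H H⊇K

  _∎ : ∀ G → Contains G G
  G ∎ = Contains-refl {G}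

retraction⇒Contains : ∀ {G H} (f : V H → V G) (g : V G → V H) → (∀ x → g (f x) ≡ x) →
  (∀ u v → E H u v → E G (f u) (f v)) → Contains G H
retraction⇒Contains f g g∘f≗id f-adj =
  f , (λ {x} {y} fx≡fy → trans (sym (g∘f≗id x)) (trans (cong g fx≡fy) (g∘f≗id y))) , f-adj

emptyG-minimal : ∀ {G} → Contains G emptyG
emptyG-minimal = (λ ()) , (λ {x} → ⊥-elim x) , λ ()

∪G-mono : ∀ {G G′ H H′} → Contains G H → Contains G′ H′ → Contains (G ∪G G′) (H ∪G H′)
∪G-mono {G} {G′} {H} {H′} (f , f-inj , f-adj) (g , g-inj , g-adj) = ⊎-map f g , inj , adj
  where
  inj : Injective _≡_ _≡_ (⊎-map f g)
  inj {inj₁ x} {inj₁ y} e = cong inj₁ (f-inj (inj₁-injective e))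
  inj {inj₂ x} {inj₂ y} e = cong inj₂ (g-inj (inj₂-injective e))
  inj {inj₁ x} {inj₂ y} ()
  inj {inj₂ x} {inj₁ y} ()
  adj : ∀ u v → E (H ∪G H′) u v → E (G ∪G G′) (⊎-map f g u) (⊎-map f g v)
  adj (inj₁ x) (inj₁ y) e = f-adj x y e
  adj (inj₂ x) (inj₂ y) e = g-adj x y e

∪G-comm : ∀ {G H} → Contains (H ∪G G) (G ∪G H)
∪G-comm {G} {H} = retraction⇒Contains {H ∪G G} {G ∪G H} swap swap swap-involutive adj
  where
  adj : ∀ u v → E (G ∪G H) u v → E (H ∪G G) (swap u) (swap v)
  adj (inj₁ x) (inj₁ y) e = e
  adj (inj₂ x) (inj₂ y) e = e

∪G-assoc : ∀ {G H K} → Contains ((G ∪G H) ∪G K) (G ∪G (H ∪G K))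
∪G-assoc {G} {H} {K} =
  retraction⇒Contains {(G ∪G H) ∪G K} {G ∪G (H ∪G K)} assocˡ assocʳ inverse adj
  where
  inverse : ∀ x → assocʳ (assocˡ x) ≡ x
  inverse (inj₁ x) = refl
  inverse (inj₂ (inj₁ y)) = refl
  inverse (inj₂ (inj₂ z)) = refl
  adj : ∀ u v → E (G ∪G (H ∪G K)) u v → E ((G ∪G H) ∪G K) (assocˡ u) (assocˡ v)
  adj (inj₁ x) (inj₁ y) e = e
  adj (inj₂ (inj₁ x)) (inj₂ (inj₁ y)) e = e
  adj (inj₂ (inj₂ x)) (inj₂ (inj₂ y)) e = e

∪G-exchange : ∀ {G H K} → Contains (H ∪G (G ∪G K)) (G ∪G (H ∪G K))
∪G-exchange {G} {H} {K} =
  retraction⇒Contains {H ∪G (G ∪G K)} {G ∪G (H ∪G K)} exchange exchange inverse adj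
  where
  exchange : ∀ {A B C : Set} → A ⊎ (B ⊎ C) → B ⊎ (A ⊎ C)
  exchange (inj₁ x) = inj₂ (inj₁ x)
  exchange (inj₂ (inj₁ y)) = inj₁ y
  exchange (inj₂ (inj₂ z)) = inj₂ (inj₂ z)
  inverse : ∀ x → exchange (exchange x) ≡ x
  inverse (inj₁ x) = refl
  inverse (inj₂ (inj₁ y)) = refl
  inverse (inj₂ (inj₂ z)) = refl
  adj : ∀ u v → E (G ∪G (H ∪G K)) u v → E (H ∪G (G ∪G K)) (exchange u) (exchange v)
  adj (inj₁ x) (inj₁ y) e = e
  adj (inj₂ (inj₁ x)) (inj₂ (inj₁ y)) e = e
  adj (inj₂ (inj₂ x)) (inj₂ (inj₂ y)) e = e

shift-adjacent : ∀ {m n} (c : ℕ) (f : Fin m → Fin n) → (∀ i → toℕ (f i) ≡ c + toℕ i) →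
  ∀ i j → E (P m) i j → E (P n) (f i) (f j)
shift-adjacent c f shift i j = ⊎-map (step i j) (step j i)
  where
  open ≡-Reasoning
  step : ∀ i j → suc (toℕ i) ≡ toℕ j → suc (toℕ (f i)) ≡ toℕ (f j)
  step i j i+1≡j = begin
    suc (toℕ (f i))  ≡⟨ cong suc (shift i) ⟩
    suc (c + toℕ i)  ≡⟨ +-suc c (toℕ i) ⟨
    c + suc (toℕ i)  ≡⟨ cong (c +_) i+1≡j ⟩
    c + toℕ j        ≡⟨ shift j ⟨
    toℕ (f j)        ∎

P-mono : ∀ {m n} → m ≤ n → Contains (P n) (P m)
P-mono m≤n = (λ i → inject≤ i m≤n) , (λ {i} {j} → inject≤-injective m≤n m≤n i j) ,
  shift-adjacent 0 _ (λ i → toℕ-inject≤ i m≤n)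

P-+ : ∀ {m n} → Contains (P (m + n)) (P m ∪G P n)
P-+ {m} {n} =
  retraction⇒Contains {P (m + n)} {P m ∪G P n} (join m n) (splitAt m) (splitAt-join m n) adj
  where
  adj : ∀ u v → E (P m ∪G P n) u v → E (P (m + n)) (join m n u) (join m n v)
  adj (inj₁ i) (inj₁ j) = shift-adjacent 0 (_↑ˡ n) (λ i → toℕ-↑ˡ i n) i j
  adj (inj₂ i) (inj₂ j) = shift-adjacent m (m ↑ʳ_) (toℕ-↑ʳ m) i j

linForest⊆P-sum : ∀ ls → Contains (P (sum ls)) (linForest ls)
linForest⊆P-sum [] = emptyG-minimal {P 0}
linForest⊆P-sum (l ∷ ls) =
  P (l + sum ls)          ⊇⟨ P-+ ⟩
  P l ∪G P (sum ls)       ⊇⟨ ∪G-mono (P l ∎) (linForest⊆P-sum ls) ⟩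
  P l ∪G linForest ls     ∎
  where open ⊇-Reasoning

linForest-interleaving : ∀ {xs ys zs} → Interleaving xs ys zs →
  Contains (linForest xs ∪G linForest ys) (linForest zs)
linForest-interleaving [] = emptyG-minimal {emptyG ∪G emptyG}
linForest-interleaving {x ∷ xs} {ys} {_ ∷ zs} (consˡ sp) =
  (P x ∪G linForest xs) ∪G linForest ys   ⊇⟨ ∪G-assoc ⟩
  P x ∪G (linForest xs ∪G linForest ys)   ⊇⟨ ∪G-mono (P x ∎) (linForest-interleaving sp) ⟩
  P x ∪G linForest zs                     ∎
  where open ⊇-Reasoning
linForest-interleaving {xs} {y ∷ ys} {_ ∷ zs} (consʳ sp) =
  linForest xs ∪G (P y ∪G linForest ys)   ⊇⟨ ∪G-exchange ⟩
  P y ∪G (linForest xs ∪G linForest ys)   ⊇⟨ ∪G-mono (P y ∎) (linForest-interleaving sp) ⟩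
  P y ∪G linForest zs                     ∎
  where open ⊇-Reasoning

halves : List ℕ → ℕ
halves ls = sum (map ⌊_/2⌋ ls)

odds : List ℕ → ℕ
odds ls = sum (map (_% 2) ls)

n%2≤1 : ∀ n → n % 2 ≤ 1
n%2≤1 n = s≤s⁻¹ (m%n<n n 2)

⌊n/2⌋+⌊n/2⌋+n%2≡n : ∀ n → ⌊ n /2⌋ + ⌊ n /2⌋ + n % 2 ≡ n
⌊n/2⌋+⌊n/2⌋+n%2≡n 0 = refl
⌊n/2⌋+⌊n/2⌋+n%2≡n 1 = refl
⌊n/2⌋+⌊n/2⌋+n%2≡n (suc (suc n)) =
  cong suc (trans (cong (_+ n % 2) (+-suc ⌊ n /2⌋ ⌊ n /2⌋)) (cong suc (⌊n/2⌋+⌊n/2⌋+n%2≡n n)))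

n/2≡⌊n/2⌋ : ∀ n → n / 2 ≡ ⌊ n /2⌋
n/2≡⌊n/2⌋ 0 = refl
n/2≡⌊n/2⌋ 1 = refl
n/2≡⌊n/2⌋ (suc (suc n)) =
  trans (m/n≡1+[m∸n]/n {suc (suc n)} {2} (s≤s (s≤s z≤n))) (cong suc (n/2≡⌊n/2⌋ n))

δ≡halves∸1 : ∀ ls → δ ls ≡ halves ls ∸ 1
δ≡halves∸1 ls = cong (λ hs → sum hs ∸ 1) (map-cong n/2≡⌊n/2⌋ ls)

halves+halves+odds≡sum : ∀ ls → halves ls + halves ls + odds ls ≡ sum ls
halves+halves+odds≡sum [] = refl
halves+halves+odds≡sum (l ∷ ls) =
  trans (regroup ⌊ l /2⌋ (halves ls) (l % 2) (odds ls))
        (cong₂ _+_ (⌊n/2⌋+⌊n/2⌋+n%2≡n l) (halves+halves+odds≡sum ls))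
  where
  regroup : ∀ h s p o → h + s + (h + s) + (p + o) ≡ h + h + p + (s + s + o)
  regroup = solve-∀

odds≤sum : ∀ ls → odds ls ≤ sum ls
odds≤sum [] = z≤n
odds≤sum (l ∷ ls) = +-mono-≤ (m%n≤m l 2) (odds≤sum ls)

sum-interleaving : ∀ {xs ys zs} → Interleaving xs ys zs → sum xs + sum ys ≡ sum zs
sum-interleaving {xs} {ys} sp = trans (sym (sum-++ xs ys)) (sym (sum-↭ (toPermutation sp)))

Admissible : ℕ → Set
Admissible ℓ = 2 ≤ ℓ × ℓ ≢ 3

admissible⇒2+parity≤ : ∀ {ℓ} → Admissible ℓ → 2 + ℓ % 2 ≤ ℓ
admissible⇒2+parity≤ {1} (s≤s () , _)
admissible⇒2+parity≤ {2} _ = ≤-refl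
admissible⇒2+parity≤ {3} (_ , ℓ≢3) = contradiction refl ℓ≢3
admissible⇒2+parity≤ {suc (suc (suc (suc ℓ)))} _ = s≤s (s≤s (≤-trans (n%2≤1 ℓ) (s≤s z≤n)))

admissible⇒parity+parity≤half : ∀ {ℓ} → Admissible ℓ → ℓ % 2 + ℓ % 2 ≤ ⌊ ℓ /2⌋
admissible⇒parity+parity≤half {1} (s≤s () , _)
admissible⇒parity+parity≤half {2} _ = z≤n
admissible⇒parity+parity≤half {3} (_ , ℓ≢3) = contradiction refl ℓ≢3
admissible⇒parity+parity≤half {suc (suc (suc (suc ℓ)))} _ =
  ≤-trans (+-mono-≤ (n%2≤1 ℓ) (n%2≤1 ℓ)) (s≤s (s≤s z≤n))

admissible∧half≤parity+parity⇒≡5 : ∀ {ℓ} → Admissible ℓ → ⌊ ℓ /2⌋ ≤ ℓ % 2 + ℓ % 2 → ℓ ≡ 5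
admissible∧half≤parity+parity⇒≡5 {1} (s≤s () , _) _
admissible∧half≤parity+parity⇒≡5 {3} (_ , ℓ≢3) _ = contradiction refl ℓ≢3
admissible∧half≤parity+parity⇒≡5 {5} _ _ = refl
admissible∧half≤parity+parity⇒≡5 {suc (suc (suc (suc (suc (suc ℓ)))))} _ 3≤parities =
  contradiction (≤-trans 3≤parities (+-mono-≤ (n%2≤1 ℓ) (n%2≤1 ℓ))) (<⇒≱ (s≤s (s≤s (s≤s z≤n))))

admissible∧half≤1⇒≡2 : ∀ {ℓ} → Admissible ℓ → ⌊ ℓ /2⌋ ≤ 1 → ℓ ≡ 2
admissible∧half≤1⇒≡2 {1} (s≤s () , _) _
admissible∧half≤1⇒≡2 {2} _ _ = refl
admissible∧half≤1⇒≡2 {3} (_ , ℓ≢3) _ = contradiction refl ℓ≢3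
admissible∧half≤1⇒≡2 {suc (suc (suc (suc ℓ)))} _ (s≤s ())

admissible⇒2+odds≤sum : ∀ {ℓ ls} → All Admissible (ℓ ∷ ls) → 2 + odds (ℓ ∷ ls) ≤ sum (ℓ ∷ ls)
admissible⇒2+odds≤sum {ℓ} {ls} (adm ∷ _) = +-mono-≤ (admissible⇒2+parity≤ adm) (odds≤sum ls)

admissible⇒odds+odds≤halves : ∀ {ls} → All Admissible ls → odds ls + odds ls ≤ halves ls
admissible⇒odds+odds≤halves [] = z≤n
admissible⇒odds+odds≤halves {ℓ ∷ ls} (adm ∷ adms) =
  subst (_≤ halves (ℓ ∷ ls)) (interchange (ℓ % 2) (odds ls))
    (+-mono-≤ (admissible⇒parity+parity≤half adm) (admissible⇒odds+odds≤halves adms))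
  where
  interchange : ∀ p o → p + p + (o + o) ≡ p + o + (p + o)
  interchange = solve-∀

admissible∧halves≤odds+odds⇒All≡5 : ∀ {ls} → All Admissible ls → halves ls ≤ odds ls + odds ls →
  All (_≡ 5) ls
admissible∧halves≤odds+odds⇒All≡5 [] _ = []
admissible∧halves≤odds+odds⇒All≡5 {ℓ ∷ ls} (adm ∷ adms) halves≤ =
  admissible∧half≤parity+parity⇒≡5 adm head≤ ∷ admissible∧halves≤odds+odds⇒All≡5 adms rest≤
  where
  p = ℓ % 2
  o = odds ls
  interchange : ∀ p o → p + o + (p + o) ≡ p + p + (o + o)
  interchange = solve-∀
  halves≤′ : ⌊ ℓ /2⌋ + halves ls ≤ p + p + (o + o)
  halves≤′ = subst (⌊ ℓ /2⌋ + halves ls ≤_) (interchange p o) halves≤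
  head≤ : ⌊ ℓ /2⌋ ≤ p + p
  head≤ = +-cancelʳ-≤ (halves ls) _ _
    (≤-trans halves≤′ (+-monoʳ-≤ (p + p) (admissible⇒odds+odds≤halves adms)))
  rest≤ : halves ls ≤ o + o
  rest≤ = +-cancelˡ-≤ ⌊ ℓ /2⌋ _ _
    (≤-trans halves≤′ (+-monoˡ-≤ (o + o) (admissible⇒parity+parity≤half adm)))

All≡5⇒halves≡odds+odds : ∀ {ls} → All (_≡ 5) ls → halves ls ≡ odds ls + odds ls
All≡5⇒halves≡odds+odds [] = refl
All≡5⇒halves≡odds+odds {_ ∷ ls} (refl ∷ fives) =
  cong suc (trans (cong suc (All≡5⇒halves≡odds+odds fives)) (sym (+-suc (odds ls) (odds ls))))

All≡5∧odds≡5⇒5P₅ : ∀ {ls} → All (_≡ 5) ls → odds ls ≡ 5 → ls ≡ 5 ∷ 5 ∷ 5 ∷ 5 ∷ 5 ∷ []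
All≡5∧odds≡5⇒5P₅ (refl ∷ refl ∷ refl ∷ refl ∷ refl ∷ []) _ = refl
All≡5∧odds≡5⇒5P₅ [] ()
All≡5∧odds≡5⇒5P₅ (refl ∷ []) ()
All≡5∧odds≡5⇒5P₅ (refl ∷ refl ∷ []) ()
All≡5∧odds≡5⇒5P₅ (refl ∷ refl ∷ refl ∷ []) ()
All≡5∧odds≡5⇒5P₅ (refl ∷ refl ∷ refl ∷ refl ∷ []) ()
All≡5∧odds≡5⇒5P₅ (refl ∷ refl ∷ refl ∷ refl ∷ refl ∷ refl ∷ _) ()

halves≤t+x⇒5P₅ : ∀ {ls x t} → All Admissible ls → x ∈ ls → x ≤ t → t ≤ odds ls →
  halves ls ≤ t + x → ls ≡ 5 ∷ 5 ∷ 5 ∷ 5 ∷ 5 ∷ []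
halves≤t+x⇒5P₅ {ls} {x} {t} adms x∈ls x≤t t≤odds halves≤ =
  All≡5∧odds≡5⇒5P₅ fives (≤-antisym odds≤5 (≤-trans (≤-reflexive (sym x≡5)) (≤-trans x≤t t≤odds)))
  where
  open ≤-Reasoning
  fives : All (_≡ 5) ls
  fives = admissible∧halves≤odds+odds⇒All≡5 adms (begin
    halves ls          ≤⟨ halves≤ ⟩
    t + x              ≤⟨ +-monoʳ-≤ t x≤t ⟩
    t + t              ≤⟨ +-mono-≤ t≤odds t≤odds ⟩
    odds ls + odds ls  ∎)
  x≡5 : x ≡ 5
  x≡5 = lookup fives x∈ls
  odds≤5 : odds ls ≤ 5
  odds≤5 = +-cancelˡ-≤ (odds ls) _ _ (begin
    odds ls + odds ls  ≡⟨ All≡5⇒halves≡odds+odds fives ⟨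
    halves ls          ≤⟨ halves≤ ⟩
    t + x              ≡⟨ cong (t +_) x≡5 ⟩
    t + 5              ≤⟨ +-monoˡ-≤ 5 t≤odds ⟩
    odds ls + 5        ∎)

∸1<⇒≤ : ∀ {m n} → m ∸ 1 < n → m ≤ n
∸1<⇒≤ {m} m∸1<n = ≤-trans (m≤n+m∸n m 1) m∸1<n

record BalancedSplit (ls : List ℕ) : Set where
  constructor balanced
  field
    part others : List ℕ
    interleaving : Interleaving part others ls
    odds<part : odds ls < sum part
    part≤halves∸1 : sum part ≤ halves ls ∸ 1

complement≤2[h∸1]+1 : ∀ {x y o h} → x + y ≡ h + h + o → o < x → x ≤ h ∸ 1 → y ≤ 2 * (h ∸ 1) + 1
complement≤2[h∸1]+1 {h = zero} _ o<x x≤0 = contradiction (≤-trans o<x x≤0) λ ()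
complement≤2[h∸1]+1 {x} {y} {o} {suc h} x+y≡ o<x _ = +-cancelˡ-≤ (suc o) _ _ (begin
  suc o + y            ≤⟨ +-monoˡ-≤ y o<x ⟩
  x + y                ≡⟨ x+y≡ ⟩
  suc h + suc h + o    ≡⟨ regroup h o ⟩
  suc o + (2 * h + 1)  ∎)
  where
  open ≤-Reasoning
  regroup : ∀ h o → suc h + suc h + o ≡ suc o + (2 * h + 1)
  regroup = solve-∀

BalancedSplit⇒Contains : ∀ {ls} → BalancedSplit ls →
  Contains (P (2 * δ ls + 1) ∪G P (δ ls)) (linForest ls)
BalancedSplit⇒Contains {ls} (balanced xs ys sp odds<xs xs≤) rewrite δ≡halves∸1 ls =
  P (2 * d + 1) ∪G P d          ⊇⟨ ∪G-mono (P-mono ys≤) (P-mono xs≤) ⟩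
  P (sum ys) ∪G P (sum xs)      ⊇⟨ ∪G-comm ⟩
  P (sum xs) ∪G P (sum ys)      ⊇⟨ ∪G-mono (linForest⊆P-sum xs) (linForest⊆P-sum ys) ⟩
  linForest xs ∪G linForest ys  ⊇⟨ linForest-interleaving sp ⟩
  linForest ls                  ∎
  where
  open ⊇-Reasoning
  d = halves ls ∸ 1
  ys≤ : sum ys ≤ 2 * d + 1
  ys≤ = complement≤2[h∸1]+1 {h = halves ls}
    (trans (sum-interleaving sp) (sym (halves+halves+odds≡sum ls))) odds<xs xs≤

record Overflow (m : ℕ) (xs : List ℕ) : Set where
  constructor overflow
  field
    prefix : List ℕ
    next : ℕ
    suffix : List ℕ
    split : xs ≡ prefix ++ next ∷ suffix
    prefix-fits : sum prefix ≤ m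
    next-overflows : m < sum prefix + next

fits⊎overflows : ∀ m xs → sum xs ≤ m ⊎ Overflow m xs
fits⊎overflows m [] = inj₁ z≤n
fits⊎overflows m (x ∷ xs) with x ≤? m
... | no x≰m = inj₂ (overflow [] x xs refl z≤n (≰⇒> x≰m))
... | yes x≤m with fits⊎overflows (m ∸ x) xs
...   | inj₁ fits = inj₁ (subst (_≤ m) (+-comm (sum xs) x) (m≤o∸n⇒m+n≤o _ x≤m fits))
...   | inj₂ (overflow pre y suf refl fits over) = inj₂ (overflow (x ∷ pre) y suf refl
  (subst (_≤ m) (+-comm (sum pre) x) (m≤o∸n⇒m+n≤o _ x≤m fits))
  (subst (m <_) (sym (+-assoc x (sum pre) y)) (≤-<-trans (m≤n+m∸n m x) (+-monoʳ-< x over))))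

short-second-path : ∀ {a b rest} → All Admissible (a ∷ b ∷ rest) → All (_≤ b) rest →
  b ≤ halves (a ∷ b ∷ rest) ∸ 1 →
  BalancedSplit (a ∷ b ∷ rest) ⊎ a ∷ b ∷ rest ≡ 5 ∷ 5 ∷ 5 ∷ 5 ∷ 5 ∷ []
short-second-path {a} {b} {rest} adms@(_ ∷ tail-adms) rest≤b b≤m
  with fits⊎overflows (halves (a ∷ b ∷ rest) ∸ 1) (b ∷ rest)
... | inj₁ fits =
  inj₁ (balanced (b ∷ rest) (a ∷ []) (consʳ (left (Pointwise.refl refl))) odds<tail fits)
  where
  odds<tail : odds (a ∷ b ∷ rest) < sum (b ∷ rest)
  odds<tail = ≤-trans (s≤s (+-monoˡ-≤ _ (n%2≤1 a))) (admissible⇒2+odds≤sum tail-adms)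
... | inj₂ (overflow [] _ _ refl _ b-overflows) = contradiction b≤m (<⇒≱ b-overflows)
... | inj₂ (overflow (_ ∷ pre) next suf refl fits overflows)
  with odds (a ∷ b ∷ rest) <? b + sum pre
...   | yes odds<pre = inj₁ (balanced (b ∷ pre) (a ∷ next ∷ suf)
          (consʳ (consˡ (++-disjoint (left (Pointwise.refl refl)) (right (Pointwise.refl refl)))))
          odds<pre fits)
...   | no odds≮pre = inj₂ (halves≤t+x⇒5P₅ adms (there (there next∈rest))
          (≤-trans (lookup rest≤b next∈rest) (m≤m+n b (sum pre))) (≮⇒≥ odds≮pre) (∸1<⇒≤ overflows))
  where
  next∈rest : next ∈ pre ++ next ∷ suf
  next∈rest = ∈-++⁺ʳ pre (here refl)

sorted⇒tail≤head : ∀ {b rest} → Linked _≥_ (b ∷ rest) → All (_≤ b) rest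
sorted⇒tail≤head sorted = AllPairs.head (Linked⇒AllPairs (λ x≥y y≥z → ≤-trans y≥z x≥y) sorted)

Exceptional : List ℕ → Set
Exceptional ls =
  (ls ≡ 5 ∷ 5 ∷ 5 ∷ 5 ∷ 5 ∷ [] ⊎ ∃ (λ ℓ → ls ≡ ℓ ∷ ℓ ∷ []) ⊎ ∃ (λ ℓ → ls ≡ suc ℓ ∷ ℓ ∷ []))
  ⊎ ∃ (λ ℓ → ℓ % 2 ≡ 1 × (ls ≡ ℓ + 2 ∷ ℓ ∷ [] ⊎ ls ≡ ℓ ∷ ℓ ∷ 2 ∷ []))

long-pair-bound : ∀ a b c → ⌊ a /2⌋ + (⌊ b /2⌋ + c) ≤ b → a + (c + c) ≤ suc (b + b % 2)
long-pair-bound a b c long = begin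
  a + (c + c)              ≤⟨ +-monoˡ-≤ (c + c) a≤ ⟩
  A + A + 1 + (c + c)      ≡⟨ regroup₁ A c ⟩
  suc (A + c + (A + c))    ≤⟨ s≤s (+-mono-≤ A+c≤B+p A+c≤B+p) ⟩
  suc (B + p + (B + p))    ≡⟨ cong suc (regroup₂ B p) ⟩
  suc (B + B + p + p)      ≡⟨ cong (λ b → suc (b + p)) (⌊n/2⌋+⌊n/2⌋+n%2≡n b) ⟩
  suc (b + p)              ∎
  where
  open ≤-Reasoning
  A = ⌊ a /2⌋
  B = ⌊ b /2⌋
  p = b % 2
  regroup₁ : ∀ A c → A + A + 1 + (c + c) ≡ suc (A + c + (A + c))
  regroup₁ = solve-∀
  regroup₂ : ∀ B p → B + p + (B + p) ≡ B + B + p + p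
  regroup₂ = solve-∀
  regroup₃ : ∀ A B c → B + (A + c) ≡ A + (B + c)
  regroup₃ = solve-∀
  a≤ : a ≤ A + A + 1
  a≤ = subst (_≤ A + A + 1) (⌊n/2⌋+⌊n/2⌋+n%2≡n a) (+-monoʳ-≤ (A + A) (n%2≤1 a))
  A+c≤B+p : A + c ≤ B + p
  A+c≤B+p = +-cancelˡ-≤ B _ _ (begin
    B + (A + c)  ≡⟨ regroup₃ A B c ⟩
    A + (B + c)  ≤⟨ long ⟩
    b            ≡⟨ ⌊n/2⌋+⌊n/2⌋+n%2≡n b ⟨
    B + B + p    ≡⟨ +-assoc B B p ⟩
    B + (B + p)  ∎)

n+2≤1+n+n%2⇒n%2≡1 : ∀ {n} → n + 2 ≤ suc (n + n % 2) → n % 2 ≡ 1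
n+2≤1+n+n%2⇒n%2≡1 {n} n+2≤ =
  ≤-antisym (n%2≤1 n) (+-cancelˡ-≤ n 1 (n % 2) (s≤s⁻¹ (subst (_≤ suc (n + n % 2)) (+-suc n 1) n+2≤)))

pair-exceptional : ∀ {a b} → b ≤ a → a ≤ suc (b + b % 2) → Exceptional (a ∷ b ∷ [])
pair-exceptional {a} {b} b≤a a≤ with m≤n⇒∃[o]m+o≡n b≤a
... | 0 , refl = inj₁ (inj₂ (inj₁ (b , cong (_∷ b ∷ []) (+-identityʳ b))))
... | 1 , refl = inj₁ (inj₂ (inj₂ (b , cong (_∷ b ∷ []) (+-comm b 1))))
... | 2 , refl = inj₂ (b , n+2≤1+n+n%2⇒n%2≡1 a≤ , inj₁ refl)
... | suc (suc (suc d)) , refl = contradiction a≤ (<⇒≱ (begin-strict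
  suc (b + b % 2)        ≤⟨ s≤s (+-monoʳ-≤ b (n%2≤1 b)) ⟩
  suc (b + 1)            ≡⟨ +-suc b 1 ⟨
  b + 2                  <⟨ +-monoʳ-< b (s≤s (s≤s (s≤s z≤n))) ⟩
  b + suc (suc (suc d))  ∎))
  where open ≤-Reasoning

triple-exceptional : ∀ {a b} → b ≤ a → a + 2 ≤ suc (b + b % 2) → Exceptional (a ∷ b ∷ 2 ∷ [])
triple-exceptional {a} {b} b≤a a+2≤ =
  inj₂ (b , b-odd , inj₂ (cong (λ ℓ → ℓ ∷ b ∷ 2 ∷ []) (≤-antisym a≤b b≤a)))
  where
  b-odd : b % 2 ≡ 1
  b-odd = n+2≤1+n+n%2⇒n%2≡1 (≤-trans (+-monoˡ-≤ 2 b≤a) a+2≤)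
  a≤b : a ≤ b
  a≤b = +-cancelʳ-≤ 2 a b
    (subst (a + 2 ≤_) (trans (cong (λ p → suc (b + p)) b-odd) (sym (+-suc b 1))) a+2≤)

long-pair-bound⇒c≤1 : ∀ {a b c} → b ≤ a → a + (c + c) ≤ suc (b + b % 2) → c ≤ 1
long-pair-bound⇒c≤1 {a} {b} {c} b≤a bound = m+m≤2⇒m≤1 (+-cancelˡ-≤ b _ _ (begin
  b + (c + c)      ≤⟨ +-monoˡ-≤ (c + c) b≤a ⟩
  a + (c + c)      ≤⟨ bound ⟩
  suc (b + b % 2)  ≤⟨ s≤s (+-monoʳ-≤ b (n%2≤1 b)) ⟩
  suc (b + 1)      ≡⟨ +-suc b 1 ⟨
  b + 2            ∎))
  where
  open ≤-Reasoning
  m+m≤2⇒m≤1 : ∀ {m} → m + m ≤ 2 → m ≤ 1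
  m+m≤2⇒m≤1 {0} _ = z≤n
  m+m≤2⇒m≤1 {1} _ = ≤-refl
  m+m≤2⇒m≤1 {suc (suc m)} (s≤s (s≤s m+2+m≤0)) =
    contradiction (subst (_≤ 0) (+-suc m (suc m)) m+2+m≤0) λ ()

halves≤1⇒[]⊎[2] : ∀ {ls} → All Admissible ls → halves ls ≤ 1 → ls ≡ [] ⊎ ls ≡ 2 ∷ []
halves≤1⇒[]⊎[2] [] _ = inj₁ refl
halves≤1⇒[]⊎[2] (adm ∷ []) half≤1 =
  inj₂ (cong (_∷ []) (admissible∧half≤1⇒≡2 adm (subst (_≤ 1) (+-identityʳ _) half≤1)))
halves≤1⇒[]⊎[2] ((ℓ≥2 , _) ∷ (ℓ′≥2 , _) ∷ _) halves≤1 =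
  contradiction halves≤1 (<⇒≱ (+-mono-≤ (⌊n/2⌋-mono ℓ≥2) (≤-trans (⌊n/2⌋-mono ℓ′≥2) (m≤m+n _ _))))

long-second-path : ∀ {a b rest} → All Admissible (a ∷ b ∷ rest) → b ≤ a →
  halves (a ∷ b ∷ rest) ≤ b → Exceptional (a ∷ b ∷ rest)
long-second-path {a} {b} {rest} (_ ∷ _ ∷ rest-adms) b≤a long
  with bound ← long-pair-bound a b (halves rest) long
  with halves≤1⇒[]⊎[2] rest-adms (long-pair-bound⇒c≤1 b≤a bound)
... | inj₁ refl = pair-exceptional b≤a (subst (_≤ suc (b + b % 2)) (+-identityʳ a) bound)
... | inj₂ refl = triple-exceptional b≤a bound

lemma6 : (ls : List ℕ) → 2 ≤ length ls → Linked _≥_ ls → All (2 ≤_) ls → All (_≢ 3) ls →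
    ¬ Contains (P (2 * δ ls + 1) ∪G P (δ ls)) (linForest ls) →
    (ls ≡ 5 ∷ 5 ∷ 5 ∷ 5 ∷ 5 ∷ [] ⊎ ∃ (λ ℓ → ls ≡ ℓ ∷ ℓ ∷ []) ⊎ ∃ (λ ℓ → ls ≡ suc ℓ ∷ ℓ ∷ []))
    ⊎ ∃ (λ ℓ → ℓ % 2 ≡ 1 × (ls ≡ ℓ + 2 ∷ ℓ ∷ [] ⊎ ls ≡ ℓ ∷ ℓ ∷ 2 ∷ []))
lemma6 (_ ∷ []) (s≤s ())
lemma6 ls@(a ∷ b ∷ rest) _ (b≤a ∷ sorted) ≥2 ≢3 F⊈
  with adms ← All.zip (≥2 , ≢3)
  with b ≤? halves ls ∸ 1
... | no b≰ = long-second-path adms b≤a (∸1<⇒≤ (≰⇒> b≰))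
... | yes b≤ with short-second-path adms (sorted⇒tail≤head sorted) b≤
...   | inj₁ split = contradiction (BalancedSplit⇒Contains split) F⊈
...   | inj₂ 5P₅ = inj₁ (inj₁ 5P₅)
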